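{- Let $\mathbb{M}=(S,(\sim_i)_{i\in\mathsf{Ag}},(P_i)_{i\in\mathsf{Ag}})$ be a probabilistic epistemic state structure with $S$ finite, and let $(E,(\sim_i),(P_i),\Phi,\mathsf{pre})$ be a classical probabilistic event structure over $\mathbb{M}$. Then $(\coprod_{\mathcal{E}}\mathbb{M})^+\cong\prod_{\mathbb{E}_{\mathcal{E}}}\mathbb{M}^+$: the bijection $\mathcal{P}(S\times E)\to\prod_{|E|}\mathcal{P}(S)$, $X\mapsto g_X$ with $g_X(e)=\{s\in S\mid (s,e)\in X\}$, is an isomorphism of the underlying algebras (Boolean operations and all $\lozenge_i,\Box_i$), maps the domain of $(P^{\coprod}_i)^+$ onto the domain of $\mu'_i$, and satisfies $(P_i^{\coprod})^+(X)=\mu'_i(g_X)$ for every $X$ in the domain of $(P_i^{\coprod})^+$.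
   Context: A probabilistic epistemic state structure is $(S,(\sim_i)_{i\in\mathsf{Ag}},(P_i)_{i\in\mathsf{Ag}})$ with $S$ nonempty, $\sim_i$ equivalence relations, and $P_i:S\to(0,1]$ summing to 1 on each $\sim_i$-class. A classical probabilistic event structure over it consists of a nonempty finite set $E$, equivalence relations $\sim_i$ on $E$, maps $P_i:E\to(0,1]$ summing to 1 on each $\sim_i$-class, a finite set $\Phi$ of (pairwise inconsistent) formulas, of which only their extensions $[\![\phi]\!]\subseteq S$ matter here, these being pairwise disjoint, and for each $\phi\in\Phi$ a probability distribution $\mathsf{pre}(\cdot\mid\phi)$ on $E$. Put $\mathsf{pre}(e\mid s)=\mathsf{pre}(e\mid\phi)$ for the unique $\phi$ with $s\in[\![\phi]\!]$, and $0$ if there is none. The intermediate structure $\coprod_{\mathcal{E}}\mathbb{M}$ has states $S\times E$, relations $(s,e)\sim_i^{\coprod}(s',e')$ iff $s\sim_is'$ and $e\sim_ie'$, and weights $P^{\coprod}_i(s,e)=P_i(s)\cdot P_i(e)\cdot\mathsf{pre}(e\mid s)$. For any such structure $(T,(\approx_i),(Q_i))$ its complex algebra is $\langle\mathcal{P}T,(\lozenge_i),(\Box_i),(Q_i^+)\rangle$ with $\lozenge_iX=\{t\mid\exists x\in X,\ t\approx_ix\}$, $\Box_iX=\{t\mid\forall x\,(t\approx_ix\Rightarrow x\in X)\}$, and $Q_i^+(X)=\sum_{x\in X}Q_i(x)$ defined exactly on subsets of a single $\approx_i$-class. $\mathbb{M}^+$ is the complex algebra of $\mathbb{M}$. For an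 epistemic Heyting algebra $\mathbb{A}$ (finite Heyting algebra with S5-like monadic operators; $\mathbb{M}^+$ is one), an element $a$ is $i$-minimal if $a\ne\bot$, $\lozenge_ia=a$ and $b<a$, $\lozenge_ib=b$ imply $b=\bot$; $\mathsf{Min}_i$ denotes the set of these and ${\downarrow}$ downsets. $\mathbb{E}_{\mathcal{E}}$ is the event structure over $\mathbb{M}^+$ with the same $E,\sim_i,P_i$, precondition multiset $\Phi_{\mathbb{M}}$ containing one copy of $[\![\phi]\!]$ for each $\phi\in\Phi$, and $\mathsf{pre}_{\mathbb{M}}(e\mid[\![\phi]\!])=\mathsf{pre}(e\mid\phi)$. $\prod_{\mathbb{E}_{\mathcal{E}}}\mathbb{M}^+$ has as support the set of maps $g:E\to\mathcal{P}S$ with pointwise Boolean operations and $(\lozenge'_ig)(e)=\bigcup\{\lozenge_ig(e')\mid e'\sim_ie\}$, $(\Box'_ig)(e)=\bigcap\{\Box_ig(e')\mid e'\sim_ie\}$, and measures $\mu'_i(g)=\sum_{e\in E}\sum_{\phi\in\Phi}P_i(e)\cdot\mu^{\phi}_i(g(e))\cdot\mathsf{pre}(e\mid\phi)$ on the domain $\mathsf{Min}_i(\prod_{\mathbb{E}_{\mathcal{E}}}\mathbb{M}^+){\downarrow}$, where $\mu^{\phi}_i(x)=P_i^+(x\cap[\![\phi]\!])-\sum_{b\in\mathrm{mb}(\phi)}P_i^+(x\cap b)$ and $\mathrm{mb}(\phi)$ is the set of maximal elements among the sets $[\![\psi]\!]$, $\psi\in\Phi$, strictly contained in $[\![\phi]\!]$.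 -}

module Defs where

open import Level using (_⊔_)
open import Function using (_∘_)
open import Data.Bool using (Bool; true; false; _∧_; _∨_; not; if_then_else_)
open import Data.Nat using (ℕ; zero; suc; _<ᵇ_)
open import Data.Fin using (Fin; zero; suc; toℕ)
open import Data.List using (List; []; _∷_; allFin; cartesianProduct)
open import Data.Bool.ListAction using (any; all)
open import Data.Product using (Σ; ∃; _×_; _,_)
open import Data.Sum using (_⊎_)
open import Data.Maybe using (Maybe; just; nothing; maybe)
import Data.Maybe as Maybe
open import Relation.Binary.PropositionalEquality using (_≡_; _≢_)
open import Relation.Binary.Core using (Rel)
open import Relation.Nullary using (¬_)
open import Algebra.Bundles using (CommutativeRing)

Sub : Set → Set
Sub A = A → Bool

BRel : Set → Set
BRel A = A → A → Bool

_≐_ : {A : Set} → Sub A → Sub A → Set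
X ≐ Y = ∀ x → X x ≡ Y x

record IsEquivB {A : Set} (r : BRel A) : Set where
  field
    reflB  : ∀ x → r x x ≡ true
    symB   : ∀ x y → r x y ≡ true → r y x ≡ true
    transB : ∀ x y z → r x y ≡ true → r y z ≡ true → r x z ≡ true

_∪ₛ_ : {A : Set} → Sub A → Sub A → Sub A
(X ∪ₛ Y) x = X x ∨ Y x

_∩ₛ_ : {A : Set} → Sub A → Sub A → Sub A
(X ∩ₛ Y) x = X x ∧ Y x

∁ₛ : {A : Set} → Sub A → Sub A
∁ₛ X x = not (X x)

∅ₛ : {A : Set} → Sub A
∅ₛ _ = false

Uₛ : {A : Set} → Sub A
Uₛ _ = true

-- Complex-algebra modal operators of a finite structure whose states are
-- enumerated by the list xs, for the (Boolean) equivalence relation r.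
◇⟨_,_⟩ : {A : Set} → List A → BRel A → Sub A → Sub A
◇⟨ xs , r ⟩ X t = any (λ x → r t x ∧ X x) xs

□⟨_,_⟩ : {A : Set} → List A → BRel A → Sub A → Sub A
□⟨ xs , r ⟩ X t = all (λ x → not (r t x) ∨ X x) xs

-- X is a subset of a single r-class (domain of the measure Q⁺)
InOneClass : {A : Set} → BRel A → Sub A → Set
InOneClass r X = ∃ λ t → ∀ x → X x ≡ true → r t x ≡ true

findFirst : ∀ {k} → (Fin k → Bool) → Maybe (Fin k)
findFirst {zero} p = nothing
findFirst {suc k} p = if p zero then just zero else Maybe.map suc (findFirst (p ∘ suc))

module Numeric {c ℓ} (R : CommutativeRing c ℓ) where
  open CommutativeRing R renaming (Carrier to K)

  ΣL : {A : Set} → List A → (A → K) → K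
  ΣL [] f = 0#
  ΣL (x ∷ xs) f = f x + ΣL xs f

  Q⁺⟨_⟩ : {A : Set} → List A → (A → K) → Sub A → K
  Q⁺⟨ xs ⟩ Q X = ΣL xs (λ x → if X x then Q x else 0#)

module Prob {c ℓ ℓ'} (R : CommutativeRing c ℓ)
            (_<_ : Rel (CommutativeRing.Carrier R) ℓ') where
  open CommutativeRing R renaming (Carrier to K)
  open Numeric R

  InHalfOpenUnit : K → Set (ℓ ⊔ ℓ')
  InHalfOpenUnit x = (0# < x) × ((x < 1#) ⊎ (x ≈ 1#))

  InUnit : K → Set (ℓ ⊔ ℓ')
  InUnit x = ((0# < x) ⊎ (0# ≈ x)) × ((x < 1#) ⊎ (x ≈ 1#))

  record EpistemicStructure (Ag : Set) (n : ℕ) : Set (c ⊔ ℓ ⊔ ℓ') where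
    field
      relS   : Ag → BRel (Fin n)
      relS-equiv : ∀ i → IsEquivB (relS i)
      PS     : Ag → Fin n → K
      PS-range : ∀ i s → InHalfOpenUnit (PS i s)
      PS-class : ∀ i s → Q⁺⟨ allFin n ⟩ (PS i) (relS i s) ≈ 1#

  -- E = Fin m, Φ = Fin k, ext φ = [[φ]] ⊆ S
  record ClassicalEvent (Ag : Set) (n m k : ℕ) : Set (c ⊔ ℓ ⊔ ℓ') where
    field
      relE   : Ag → BRel (Fin m)
      relE-equiv : ∀ i → IsEquivB (relE i)
      PE     : Ag → Fin m → K
      PE-range : ∀ i e → InHalfOpenUnit (PE i e)
      PE-class : ∀ i e → Q⁺⟨ allFin m ⟩ (PE i) (relE i e) ≈ 1#
      ext    : Fin k → Sub (Fin n)
      ext-disjoint : ∀ φ ψ → φ ≢ ψ → ∀ s → ext φ s ≡ true → ext ψ s ≡ false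
      pre    : Fin k → Fin m → K          -- pre (e | φ) = pre φ e
      pre-range : ∀ φ e → InUnit (pre φ e)
      pre-sum : ∀ φ → ΣL (allFin m) (pre φ) ≈ 1#

  module Construction {Ag : Set} {n m k : ℕ}
                      (M : EpistemicStructure Ag n) (ℰ : ClassicalEvent Ag n m k) where
    open EpistemicStructure M
    open ClassicalEvent ℰ

    Sₗ : List (Fin n)
    Sₗ = allFin n

    Eₗ : List (Fin m)
    Eₗ = allFin m

    -- pre(e | s): pre(e | φ) for the unique φ with s ∈ [[φ]], 0 if none
    preS : Fin m → Fin n → K
    preS e s = maybe (λ φ → pre φ e) 0# (findFirst (λ φ → ext φ s))

    SE : Set
    SE = Fin n × Fin m

    SEₗ : List SE
    SEₗ = cartesianProduct Sₗ Eₗ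

    rel∐ : Ag → BRel SE
    rel∐ i (s , e) (s' , e') = relS i s s' ∧ relE i e e'

    P∐ : Ag → SE → K
    P∐ i (s , e) = PS i s * PE i e * preS e s

    ◇∐ : Ag → Sub SE → Sub SE
    ◇∐ i = ◇⟨ SEₗ , rel∐ i ⟩

    □∐ : Ag → Sub SE → Sub SE
    □∐ i = □⟨ SEₗ , rel∐ i ⟩

    P∐⁺ : Ag → Sub SE → K
    P∐⁺ i = Q⁺⟨ SEₗ ⟩ (P∐ i)

    ◇S : Ag → Sub (Fin n) → Sub (Fin n)
    ◇S i = ◇⟨ Sₗ , relS i ⟩

    □S : Ag → Sub (Fin n) → Sub (Fin n)
    □S i = □⟨ Sₗ , relS i ⟩

    PS⁺ : Ag → Sub (Fin n) → K
    PS⁺ i = Q⁺⟨ Sₗ ⟩ (PS i)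

    G : Set
    G = Fin m → Sub (Fin n)

    _≐ᴳ_ : G → G → Set
    f ≐ᴳ h = ∀ e → f e ≐ h e

    _≤ᴳ_ : G → G → Set
    f ≤ᴳ h = ∀ e s → f e s ≡ true → h e s ≡ true

    _∪ᴳ_ : G → G → G
    (f ∪ᴳ h) e = f e ∪ₛ h e

    _∩ᴳ_ : G → G → G
    (f ∩ᴳ h) e = f e ∩ₛ h e

    ∁ᴳ : G → G
    ∁ᴳ f e = ∁ₛ (f e)

    ⊥ᴳ : G
    ⊥ᴳ _ = ∅ₛ

    ⊤ᴳ : G
    ⊤ᴳ _ = Uₛ

    ◇' : Ag → G → G
    ◇' i f e s = any (λ e' → relE i e' e ∧ ◇S i (f e') s) Eₗ

    □' : Ag → G → G
    □' i f e s = all (λ e' → not (relE i e' e) ∨ □S i (f e') s) Eₗ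

    IsMin : Ag → G → Set
    IsMin i a = (¬ (a ≐ᴳ ⊥ᴳ)) × (◇' i a ≐ᴳ a)
              × (∀ b → b ≤ᴳ a → ¬ (b ≐ᴳ a) → ◇' i b ≐ᴳ b → b ≐ᴳ ⊥ᴳ)

    Dom' : Ag → G → Set
    Dom' i f = ∃ λ a → IsMin i a × (f ≤ᴳ a)

    ⊆ᵇ : Sub (Fin n) → Sub (Fin n) → Bool
    ⊆ᵇ X Y = all (λ s → not (X s) ∨ Y s) Sₗ

    ≡ᵇ : Sub (Fin n) → Sub (Fin n) → Bool
    ≡ᵇ X Y = ⊆ᵇ X Y ∧ ⊆ᵇ Y X

    ⊊ᵇ : Sub (Fin n) → Sub (Fin n) → Bool
    ⊊ᵇ X Y = ⊆ᵇ X Y ∧ not (⊆ᵇ Y X)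

    Φₗ : List (Fin k)
    Φₗ = allFin k

    -- ψ is the chosen (first-index) representative of the set [[ψ]]
    -- and [[ψ]] ∈ mb(φ): maximal among the sets [[χ]], χ ∈ Φ, with [[χ]] ⊊ [[φ]].
    -- (mb(φ) is a set of subsets, so each such subset is counted once.)
    inMb : Fin k → Fin k → Bool
    inMb φ ψ = ⊊ᵇ (ext ψ) (ext φ)
             ∧ not (any (λ χ → ⊊ᵇ (ext χ) (ext φ) ∧ ⊊ᵇ (ext ψ) (ext χ)) Φₗ)
             ∧ not (any (λ χ → (toℕ χ <ᵇ toℕ ψ) ∧ ≡ᵇ (ext χ) (ext ψ)) Φₗ)

    μφ : Ag → Fin k → Sub (Fin n) → K
    μφ i φ x = PS⁺ i (x ∩ₛ ext φ)
             - ΣL Φₗ (λ ψ → if inMb φ ψ then PS⁺ i (x ∩ₛ ext ψ) else 0#)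

    μ' : Ag → G → K
    μ' i f = ΣL Eₗ (λ e → ΣL Φₗ (λ φ → PE i e * μφ i φ (f e) * pre φ e))

    gOf : Sub SE → G
    gOf X e s = X (s , e)

    unG : G → Sub SE
    unG f (s , e) = f e s

-- Reading X ⊆ S × E as the family e ↦ {s | (s , e) ∈ X} commutes with the Boolean operations
-- pointwise, and since ∼ᵢ on S × E is the product of ∼ᵢ on S and on E it turns ◇ᵢ, □ᵢ into ◇'ᵢ, □'ᵢ.
-- The i-minimal elements of the product algebra are exactly the images of the ∼ᵢ-classes of ∐,
-- which matches the two domains. For the measures: the preconditions are pairwise disjoint, so
-- every member of mb(φ) is empty and μ^φ_i(x) = P_i⁺(x ∩ [[φ]]); summing
-- P_i(e) · P_i⁺(x ∩ [[φ]]) · pre(e | φ) over φ then picks out, for each s, the unique φ with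
-- s ∈ [[φ]], producing the factor pre(e | s) of P∐_i.
module Submission where

open import Defs
open import Data.Nat using (ℕ; zero; suc)
open import Data.Bool using (Bool; true; false; _∧_; _∨_; not; if_then_else_)
open import Data.Bool.Properties using (¬-not; ∧-zeroʳ) renaming (_≟_ to _≟ᵇ_)
open import Data.Bool.ListAction using (any; all)
open import Data.List using (List; []; _∷_; _++_; map; allFin; cartesianProduct)
open import Data.List.Properties using (map-tabulate)
open import Data.List.Membership.Propositional using (_∈_)
open import Data.List.Membership.Propositional.Properties using (∈-allFin; ∈-cartesianProduct⁺)
open import Data.List.Relation.Unary.Any using (here; there)
open import Data.Fin using (Fin; zero; suc)
open import Data.Fin.Properties using (¬∀⟶∃¬; all?; suc-injective) renaming (_≟_ to _≟ᶠ_)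
open import Data.Maybe using (maybe′) renaming (map to mapᴹ)
open import Data.Maybe.Properties using (maybe′-map)
open import Data.Product using (∃; ∃₂; _×_; _,_; proj₁; proj₂)
open import Data.Empty using (⊥-elim)
open import Function using (_∘_)
open import Relation.Binary.Core using (Rel)
open import Relation.Binary.Structures using (IsStrictPartialOrder)
open import Relation.Binary.PropositionalEquality using (_≡_; _≢_; refl; cong)
import Relation.Binary.PropositionalEquality as ≡
open import Relation.Nullary using (¬_; yes; no)
open import Relation.Nullary.Decidable using (decidable-stable)
open import Algebra.Bundles using (CommutativeRing)

∧-true⁻ : ∀ {a b} → a ∧ b ≡ true → a ≡ true × b ≡ true
∧-true⁻ {true} {true} refl = refl , refl

∧-true⁺ : ∀ {a b} → a ≡ true → b ≡ true → a ∧ b ≡ true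
∧-true⁺ refl refl = refl

⇒-true⁻ : ∀ {a b} → not a ∨ b ≡ true → a ≡ true → b ≡ true
⇒-true⁻ {true} b≡true refl = b≡true

⇒-true⁺ : ∀ {a b} → (a ≡ true → b ≡ true) → not a ∨ b ≡ true
⇒-true⁺ {false} _ = refl
⇒-true⁺ {true} a⇒b = a⇒b refl

true⇔true⇒≡ : ∀ {a b} → (a ≡ true → b ≡ true) → (b ≡ true → a ≡ true) → a ≡ b
true⇔true⇒≡ {false} {false} _ _ = refl
true⇔true⇒≡ {false} {true} _ b⇒a = b⇒a refl
true⇔true⇒≡ {true} {false} a⇒b _ = ≡.sym (a⇒b refl)
true⇔true⇒≡ {true} {true} _ _ = refl

module _ {A : Set} (p : A → Bool) where

  any-true⁻ : ∀ xs → any p xs ≡ true → ∃ λ x → p x ≡ true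
  any-true⁻ (x ∷ xs) h with p x in px
  ... | true = x , px
  ... | false = any-true⁻ xs h

  any-true⁺ : ∀ {x xs} → x ∈ xs → p x ≡ true → any p xs ≡ true
  any-true⁺ (here refl) px rewrite px = refl
  any-true⁺ {xs = y ∷ _} (there x∈xs) px with p y
  ... | true = refl
  ... | false = any-true⁺ x∈xs px

  all-true⁻ : ∀ {x xs} → all p xs ≡ true → x ∈ xs → p x ≡ true
  all-true⁻ h (here refl) = proj₁ (∧-true⁻ h)
  all-true⁻ h (there x∈xs) = all-true⁻ (proj₂ (∧-true⁻ h)) x∈xs

  all-true⁺ : ∀ xs → (∀ x → p x ≡ true) → all p xs ≡ true
  all-true⁺ [] _ = refl
  all-true⁺ (x ∷ xs) h = ∧-true⁺ (h x) (all-true⁺ xs h)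

module FiniteSums {c ℓ} (R : CommutativeRing c ℓ) where
  open CommutativeRing R hiding (zero) renaming (Carrier to K; refl to ≈-refl; sym to ≈-sym; trans to ≈-trans)
  open Numeric R
  open import Algebra.Properties.CommutativeSemigroup +-commutativeSemigroup using (interchange)
  open import Relation.Binary.Reasoning.Setoid setoid

  ΣL-cong : ∀ {A : Set} (xs : List A) {f g : A → K} → (∀ x → f x ≈ g x) → ΣL xs f ≈ ΣL xs g
  ΣL-cong [] _ = ≈-refl
  ΣL-cong (x ∷ xs) f≈g = +-cong (f≈g x) (ΣL-cong xs f≈g)

  ΣL-zero : ∀ {A : Set} (xs : List A) {f : A → K} → (∀ x → f x ≈ 0#) → ΣL xs f ≈ 0#
  ΣL-zero [] _ = ≈-refl
  ΣL-zero (x ∷ xs) f≈0 = ≈-trans (+-cong (f≈0 x) (ΣL-zero xs f≈0)) (+-identityʳ 0#)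

  ΣL-++ : ∀ {A : Set} (xs ys : List A) (f : A → K) → ΣL (xs ++ ys) f ≈ ΣL xs f + ΣL ys f
  ΣL-++ [] ys f = ≈-sym (+-identityˡ _)
  ΣL-++ (x ∷ xs) ys f = ≈-trans (+-congˡ (ΣL-++ xs ys f)) (≈-sym (+-assoc _ _ _))

  ΣL-map : ∀ {A B : Set} (h : A → B) (xs : List A) (f : B → K) → ΣL (map h xs) f ≡ ΣL xs (f ∘ h)
  ΣL-map h [] f = refl
  ΣL-map h (x ∷ xs) f = cong (f (h x) +_) (ΣL-map h xs f)

  ΣL-+ : ∀ {A : Set} (xs : List A) (f g : A → K) → ΣL xs (λ x → f x + g x) ≈ ΣL xs f + ΣL xs g
  ΣL-+ [] f g = ≈-sym (+-identityʳ 0#)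
  ΣL-+ (x ∷ xs) f g = ≈-trans (+-congˡ (ΣL-+ xs f g)) (interchange _ _ _ _)

  ΣL-*ˡ : ∀ {A : Set} (xs : List A) (a : K) (f : A → K) → a * ΣL xs f ≈ ΣL xs (λ x → a * f x)
  ΣL-*ˡ [] a f = zeroʳ a
  ΣL-*ˡ (x ∷ xs) a f = ≈-trans (distribˡ a _ _) (+-congˡ (ΣL-*ˡ xs a f))

  ΣL-*ʳ : ∀ {A : Set} (xs : List A) (a : K) (f : A → K) → ΣL xs f * a ≈ ΣL xs (λ x → f x * a)
  ΣL-*ʳ [] a f = zeroˡ a
  ΣL-*ʳ (x ∷ xs) a f = ≈-trans (distribʳ a _ _) (+-congˡ (ΣL-*ʳ xs a f))

  ΣL-swap : ∀ {A B : Set} (xs : List A) (ys : List B) (g : A → B → K) →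
            ΣL xs (λ x → ΣL ys (g x)) ≈ ΣL ys (λ y → ΣL xs (λ x → g x y))
  ΣL-swap [] ys g = ≈-sym (ΣL-zero ys (λ _ → ≈-refl))
  ΣL-swap (x ∷ xs) ys g =
    ≈-trans (+-congˡ (ΣL-swap xs ys g)) (≈-sym (ΣL-+ ys (g x) (λ y → ΣL xs (λ x → g x y))))

  ΣL-cartesianProduct : ∀ {A B : Set} (xs : List A) (ys : List B) (f : A × B → K) →
                        ΣL (cartesianProduct xs ys) f ≈ ΣL xs (λ x → ΣL ys (λ y → f (x , y)))
  ΣL-cartesianProduct [] ys f = ≈-refl
  ΣL-cartesianProduct (x ∷ xs) ys f = begin
    ΣL (map (x ,_) ys ++ cartesianProduct xs ys) f
      ≈⟨ ΣL-++ (map (x ,_) ys) (cartesianProduct xs ys) f ⟩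
    ΣL (map (x ,_) ys) f + ΣL (cartesianProduct xs ys) f
      ≡⟨ cong (_+ _) (ΣL-map (x ,_) ys f) ⟩
    ΣL ys (λ y → f (x , y)) + ΣL (cartesianProduct xs ys) f
      ≈⟨ +-congˡ (ΣL-cartesianProduct xs ys f) ⟩
    ΣL ys (λ y → f (x , y)) + ΣL xs (λ x → ΣL ys (λ y → f (x , y))) ∎

  ΣL-allFin-suc : ∀ {j} (f : Fin (suc j) → K) → ΣL (allFin (suc j)) f ≡ f zero + ΣL (allFin j) (f ∘ suc)
  ΣL-allFin-suc {j} f =
    cong (f zero +_) (≡.trans (cong (λ xs → ΣL xs f) (≡.sym (map-tabulate (λ i → i) suc))) (ΣL-map suc (allFin j) f))

  ΣL-indicator≈findFirst : ∀ {j} (p : Fin j → Bool) (f : Fin j → K) →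
                           (∀ φ ψ → φ ≢ ψ → p φ ≡ true → p ψ ≡ false) →
                           ΣL (allFin j) (λ φ → if p φ then f φ else 0#) ≈ maybe′ f 0# (findFirst p)
  ΣL-indicator≈findFirst {zero} p f atMostOne = ≈-refl
  ΣL-indicator≈findFirst {suc j} p f atMostOne
    rewrite ΣL-allFin-suc (λ φ → if p φ then f φ else 0#) with p zero in p0
  ... | true = ≈-trans (+-congˡ (ΣL-zero (allFin j) rest≈0)) (+-identityʳ _)
    where
    rest≈0 : ∀ φ → (if p (suc φ) then f (suc φ) else 0#) ≈ 0#
    rest≈0 φ rewrite atMostOne zero (suc φ) (λ ()) p0 = ≈-refl
  ... | false = begin
    0# + ΣL (allFin j) (λ φ → if p (suc φ) then f (suc φ) else 0#)
      ≈⟨ +-identityˡ _ ⟩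
    ΣL (allFin j) (λ φ → if p (suc φ) then f (suc φ) else 0#)
      ≈⟨ ΣL-indicator≈findFirst (p ∘ suc) (f ∘ suc) (λ φ ψ φ≢ψ → atMostOne (suc φ) (suc ψ) (φ≢ψ ∘ suc-injective)) ⟩
    maybe′ (f ∘ suc) 0# (findFirst (p ∘ suc))
      ≡⟨ maybe′-map f 0# suc (findFirst (p ∘ suc)) ⟨
    maybe′ f 0# (mapᴹ suc (findFirst (p ∘ suc))) ∎

module _ {c ℓ ℓ'} {R : CommutativeRing c ℓ} {_<_ : Rel (CommutativeRing.Carrier R) ℓ'}
         {Ag : Set} {n m k : ℕ}
         (M : Prob.EpistemicStructure R _<_ Ag n) (ℰ : Prob.ClassicalEvent R _<_ Ag n m k) where
  open Prob.Construction R _<_ M ℰ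
  open Prob.EpistemicStructure M
  open Prob.ClassicalEvent ℰ
  open CommutativeRing R
    using (_≈_; _+_; _*_; -_; 0#; setoid; +-congˡ; *-congˡ; *-congʳ; *-comm; +-identityʳ; zeroˡ; zeroʳ; -‿cong)
    renaming (refl to ≈-refl; sym to ≈-sym; trans to ≈-trans)
  open Numeric R
  open FiniteSums R
  open import Algebra.Properties.Ring (CommutativeRing.ring R) using (-0#≈0#)
  open import Relation.Binary.Reasoning.Setoid setoid

  private
    module RelS i = IsEquivB (relS-equiv i)
    module RelE i = IsEquivB (relE-equiv i)

  ◇'-intro : ∀ i (f : G) {e e' s s'} → relE i e' e ≡ true → relS i s s' ≡ true → f e' s' ≡ true →
             ◇' i f e s ≡ true
  ◇'-intro i f {e} {e'} {s} {s'} e'∼e s∼s' fe's' =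
    any-true⁺ (λ e' → relE i e' e ∧ ◇S i (f e') s) (∈-allFin e')
      (∧-true⁺ e'∼e (any-true⁺ (λ s' → relS i s s' ∧ f e' s') (∈-allFin s') (∧-true⁺ s∼s' fe's')))

  ◇'-elim : ∀ i (f : G) {e s} → ◇' i f e s ≡ true →
            ∃₂ λ e' s' → relE i e' e ≡ true × relS i s s' ≡ true × f e' s' ≡ true
  ◇'-elim i f {e} {s} h with any-true⁻ (λ e' → relE i e' e ∧ ◇S i (f e') s) Eₗ h
  ... | e' , h' with ∧-true⁻ h'
  ... | e'∼e , ◇fe' with any-true⁻ (λ s' → relS i s s' ∧ f e' s') Sₗ ◇fe'
  ... | s' , h'' = e' , s' , e'∼e , ∧-true⁻ h''

  gOf-◇∐ : ∀ i X → gOf (◇∐ i X) ≐ᴳ ◇' i (gOf X)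
  gOf-◇∐ i X e s = true⇔true⇒≡ to from
    where
    to : ◇∐ i X (s , e) ≡ true → ◇' i (gOf X) e s ≡ true
    to h with any-true⁻ (λ t → rel∐ i (s , e) t ∧ X t) SEₗ h
    ... | (s' , e') , h' with ∧-true⁻ h'
    ... | se∼s'e' , Xs'e' with ∧-true⁻ se∼s'e'
    ... | s∼s' , e∼e' = ◇'-intro i (gOf X) (RelE.symB i _ _ e∼e') s∼s' Xs'e'
    from : ◇' i (gOf X) e s ≡ true → ◇∐ i X (s , e) ≡ true
    from h with ◇'-elim i (gOf X) h
    ... | e' , s' , e'∼e , s∼s' , Xs'e' =
      any-true⁺ (λ t → rel∐ i (s , e) t ∧ X t) (∈-cartesianProduct⁺ (∈-allFin s') (∈-allFin e'))
        (∧-true⁺ (∧-true⁺ s∼s' (RelE.symB i _ _ e'∼e)) Xs'e')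

  gOf-□∐ : ∀ i X → gOf (□∐ i X) ≐ᴳ □' i (gOf X)
  gOf-□∐ i X e s = true⇔true⇒≡ to from
    where
    to : □∐ i X (s , e) ≡ true → □' i (gOf X) e s ≡ true
    to h = all-true⁺ (λ e' → not (relE i e' e) ∨ □S i (gOf X e') s) Eₗ λ e' →
      ⇒-true⁺ {relE i e' e} λ e'∼e → all-true⁺ (λ s' → not (relS i s s') ∨ X (s' , e')) Sₗ λ s' →
      ⇒-true⁺ {relS i s s'} λ s∼s' →
        ⇒-true⁻ {relS i s s' ∧ relE i e e'} (all-true⁻ (λ t → not (rel∐ i (s , e) t) ∨ X t) h
                   (∈-cartesianProduct⁺ (∈-allFin s') (∈-allFin e')))
                (∧-true⁺ s∼s' (RelE.symB i _ _ e'∼e))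
    from : □' i (gOf X) e s ≡ true → □∐ i X (s , e) ≡ true
    from h = all-true⁺ (λ t → not (rel∐ i (s , e) t) ∨ X t) SEₗ λ { (s' , e') →
      ⇒-true⁺ {relS i s s' ∧ relE i e e'} λ se∼s'e' → let (s∼s' , e∼e') = ∧-true⁻ se∼s'e' in
        ⇒-true⁻ {relS i s s'} (all-true⁻ (λ s' → not (relS i s s') ∨ X (s' , e'))
                   (⇒-true⁻ {relE i e' e} (all-true⁻ (λ e' → not (relE i e' e) ∨ □S i (gOf X e') s) h (∈-allFin e'))
                            (RelE.symB i _ _ e∼e'))
                   (∈-allFin s'))
                s∼s' }

  -- Both are classical steps, made constructive by the finiteness of S and E.
  ≢⊥ᴳ⇒witness : (f : G) → ¬ (f ≐ᴳ ⊥ᴳ) → ∃₂ λ e s → f e s ≡ true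
  ≢⊥ᴳ⇒witness f f≢⊥ with ¬∀⟶∃¬ m (λ e → ∀ s → f e s ≡ false) (λ e → all? (λ s → f e s ≟ᵇ false)) f≢⊥
  ... | e , fe≢∅ with ¬∀⟶∃¬ n (λ s → f e s ≡ false) (λ s → f e s ≟ᵇ false) fe≢∅
  ... | s , fes≢false = e , s , ¬-not fes≢false

  ≐ᴳ-stable : {f h : G} → ¬ ¬ (f ≐ᴳ h) → f ≐ᴳ h
  ≐ᴳ-stable {f} {h} ¬¬f≐h e s = decidable-stable (f e s ≟ᵇ h e s) λ fes≢hes → ¬¬f≐h λ f≐h → fes≢hes (f≐h e s)

  classᴳ : Ag → SE → G
  classᴳ i t = gOf (rel∐ i t)

  classᴳ-nonempty : ∀ i t → ¬ (classᴳ i t ≐ᴳ ⊥ᴳ)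
  classᴳ-nonempty i (s , e) empty with ≡.trans (≡.sym (empty e s)) (∧-true⁺ (RelS.reflB i s) (RelE.reflB i e))
  ... | ()

  classᴳ-sym : ∀ i {s₀ e₀ s e} → classᴳ i (s₀ , e₀) e s ≡ true → classᴳ i (s , e) e₀ s₀ ≡ true
  classᴳ-sym i c with ∧-true⁻ c
  ... | s₀∼s , e₀∼e = ∧-true⁺ (RelS.symB i _ _ s₀∼s) (RelE.symB i _ _ e₀∼e)

  classᴳ-closed : ∀ i t → ◇' i (classᴳ i t) ≐ᴳ classᴳ i t
  classᴳ-closed i (s₀ , e₀) e s = true⇔true⇒≡ to from
    where
    to : ◇' i (classᴳ i (s₀ , e₀)) e s ≡ true → classᴳ i (s₀ , e₀) e s ≡ true
    to h with ◇'-elim i (classᴳ i (s₀ , e₀)) h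
    ... | e' , s' , e'∼e , s∼s' , c with ∧-true⁻ c
    ... | s₀∼s' , e₀∼e' =
      ∧-true⁺ (RelS.transB i _ _ _ s₀∼s' (RelS.symB i _ _ s∼s')) (RelE.transB i _ _ _ e₀∼e' e'∼e)
    from : classᴳ i (s₀ , e₀) e s ≡ true → ◇' i (classᴳ i (s₀ , e₀)) e s ≡ true
    from = ◇'-intro i (classᴳ i (s₀ , e₀)) (RelE.reflB i e) (RelS.reflB i s)

  closed⇒classᴳ≤ᴳ : ∀ i (b : G) → ◇' i b ≐ᴳ b → ∀ {e s} → b e s ≡ true → classᴳ i (s , e) ≤ᴳ b
  closed⇒classᴳ≤ᴳ i b b-closed bes e' s' c with ∧-true⁻ c
  ... | s∼s' , e∼e' = ≡.trans (≡.sym (b-closed e' s')) (◇'-intro i b e∼e' (RelS.symB i _ _ s∼s') bes)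

  classᴳ-isMin : ∀ i t → IsMin i (classᴳ i t)
  classᴳ-isMin i t = classᴳ-nonempty i t , classᴳ-closed i t , minimal
    where
    minimal : ∀ b → b ≤ᴳ classᴳ i t → ¬ (b ≐ᴳ classᴳ i t) → ◇' i b ≐ᴳ b → b ≐ᴳ ⊥ᴳ
    minimal b b≤C b≢C b-closed e s with b e s in bes
    ... | false = refl
    ... | true = ⊥-elim (b≢C λ e' s' → true⇔true⇒≡ (b≤C e' s') (classᴳ≤b e' s' ∘ C≤classᴳ e' s'))
      where
      classᴳ≤b : classᴳ i (s , e) ≤ᴳ b
      classᴳ≤b = closed⇒classᴳ≤ᴳ i b b-closed bes
      C≤classᴳ : classᴳ i t ≤ᴳ classᴳ i (s , e)
      C≤classᴳ = closed⇒classᴳ≤ᴳ i (classᴳ i (s , e)) (classᴳ-closed i (s , e)) (classᴳ-sym i (b≤C e s bes))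

  isMin⇒≐classᴳ : ∀ i {a} → IsMin i a → ∀ {e s} → a e s ≡ true → classᴳ i (s , e) ≐ᴳ a
  isMin⇒≐classᴳ i {a} (_ , a-closed , a-minimal) {e} {s} aes = ≐ᴳ-stable λ C≢a →
    classᴳ-nonempty i (s , e) (a-minimal (classᴳ i (s , e)) (closed⇒classᴳ≤ᴳ i a a-closed aes) C≢a
                                         (classᴳ-closed i (s , e)))

  InOneClass⇒Dom' : ∀ i X → InOneClass (rel∐ i) X → Dom' i (gOf X)
  InOneClass⇒Dom' i X (t , X⊆class) = classᴳ i t , classᴳ-isMin i t , λ e s → X⊆class (s , e)

  Dom'⇒InOneClass : ∀ i X → Dom' i (gOf X) → InOneClass (rel∐ i) X
  Dom'⇒InOneClass i X (a , a-min , X≤a) with ≢⊥ᴳ⇒witness a (proj₁ a-min)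
  ... | e₀ , s₀ , ae₀s₀ = (s₀ , e₀) , λ { (s , e) Xse → ≡.trans (C≐a e s) (X≤a e s Xse) }
    where
    C≐a : classᴳ i (s₀ , e₀) ≐ᴳ a
    C≐a = isMin⇒≐classᴳ i a-min ae₀s₀

  ⊆ᵇ-refl : ∀ X → ⊆ᵇ X X ≡ true
  ⊆ᵇ-refl X = all-true⁺ (λ s → not (X s) ∨ X s) Sₗ λ s → ⇒-true⁺ {X s} (λ Xs → Xs)

  ⊆ᵇ⁻ : ∀ {X Y} → ⊆ᵇ X Y ≡ true → ∀ {s} → X s ≡ true → Y s ≡ true
  ⊆ᵇ⁻ {X} {Y} X⊆Y {s} = ⇒-true⁻ {X s} (all-true⁻ (λ s → not (X s) ∨ Y s) X⊆Y (∈-allFin s))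

  -- A precondition strictly below another is disjoint from it, hence empty.
  inMb⇒ext≡∅ : ∀ {φ ψ} → inMb φ ψ ≡ true → ∀ s → ext ψ s ≡ false
  inMb⇒ext≡∅ {φ} {ψ} ψ∈mbφ s = ¬-not ψs≢true
    where
    ψ⊊φ : ⊆ᵇ (ext ψ) (ext φ) ≡ true × not (⊆ᵇ (ext φ) (ext ψ)) ≡ true
    ψ⊊φ = ∧-true⁻ (proj₁ (∧-true⁻ ψ∈mbφ))
    ψs≢true : ext ψ s ≢ true
    ψs≢true ψs with φ ≟ᶠ ψ
    ... | yes refl with ≡.trans (≡.sym (proj₂ ψ⊊φ)) (cong not (⊆ᵇ-refl (ext φ)))
    ... | ()
    ψs≢true ψs | no φ≢ψ with ≡.trans (≡.sym ψs) (ext-disjoint φ ψ φ≢ψ s (⊆ᵇ⁻ {ext ψ} {ext φ} (proj₁ ψ⊊φ) ψs))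
    ... | ()

  PS⁺-∩-empty : ∀ i x Y → (∀ s → Y s ≡ false) → PS⁺ i (x ∩ₛ Y) ≈ 0#
  PS⁺-∩-empty i x Y Y≡∅ = ΣL-zero Sₗ term≈0
    where
    term≈0 : ∀ s → (if x s ∧ Y s then PS i s else 0#) ≈ 0#
    term≈0 s rewrite Y≡∅ s | ∧-zeroʳ (x s) = ≈-refl

  μφ≈PS⁺-∩ext : ∀ i φ x → μφ i φ x ≈ PS⁺ i (x ∩ₛ ext φ)
  μφ≈PS⁺-∩ext i φ x = begin
    PS⁺ i (x ∩ₛ ext φ) + - ΣL Φₗ (λ ψ → if inMb φ ψ then PS⁺ i (x ∩ₛ ext ψ) else 0#)
      ≈⟨ +-congˡ (-‿cong (ΣL-zero Φₗ mb-term≈0)) ⟩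
    PS⁺ i (x ∩ₛ ext φ) + - 0#
      ≈⟨ +-congˡ -0#≈0# ⟩
    PS⁺ i (x ∩ₛ ext φ) + 0#
      ≈⟨ +-identityʳ _ ⟩
    PS⁺ i (x ∩ₛ ext φ) ∎
    where
    mb-term≈0 : ∀ ψ → (if inMb φ ψ then PS⁺ i (x ∩ₛ ext ψ) else 0#) ≈ 0#
    mb-term≈0 ψ with inMb φ ψ in ψ∈mbφ
    ... | false = ≈-refl
    ... | true = PS⁺-∩-empty i x (ext ψ) (inMb⇒ext≡∅ ψ∈mbφ)

  ΣL-pre-ext≈preS : ∀ e s → ΣL Φₗ (λ φ → if ext φ s then pre φ e else 0#) ≈ preS e s
  ΣL-pre-ext≈preS e s =
    ΣL-indicator≈findFirst (λ φ → ext φ s) (λ φ → pre φ e) (λ φ ψ φ≢ψ → ext-disjoint φ ψ φ≢ψ s)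

  ΣΦ-μφ≈ΣS-P∐ : ∀ i (X : Sub SE) e →
                ΣL Φₗ (λ φ → PE i e * μφ i φ (gOf X e) * pre φ e)
                ≈ ΣL Sₗ (λ s → if X (s , e) then P∐ i (s , e) else 0#)
  ΣΦ-μφ≈ΣS-P∐ i X e = begin
    ΣL Φₗ (λ φ → PE i e * μφ i φ (gOf X e) * pre φ e)
      ≈⟨ ΣL-cong Φₗ (λ φ → *-congʳ (*-congˡ (μφ≈PS⁺-∩ext i φ (gOf X e)))) ⟩
    ΣL Φₗ (λ φ → PE i e * PS⁺ i (gOf X e ∩ₛ ext φ) * pre φ e)
      ≈⟨ ΣL-cong Φₗ (λ φ → ≈-trans (*-congʳ (ΣL-*ˡ Sₗ _ _)) (ΣL-*ʳ Sₗ _ _)) ⟩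
    ΣL Φₗ (λ φ → ΣL Sₗ (λ s → PE i e * (if X (s , e) ∧ ext φ s then PS i s else 0#) * pre φ e))
      ≈⟨ ΣL-swap Φₗ Sₗ _ ⟩
    ΣL Sₗ (λ s → ΣL Φₗ (λ φ → PE i e * (if X (s , e) ∧ ext φ s then PS i s else 0#) * pre φ e))
      ≈⟨ ΣL-cong Sₗ (λ s → at s (X (s , e))) ⟩
    ΣL Sₗ (λ s → if X (s , e) then P∐ i (s , e) else 0#) ∎
    where
    term : ∀ s φ → PE i e * (if ext φ s then PS i s else 0#) * pre φ e
                   ≈ (PS i s * PE i e) * (if ext φ s then pre φ e else 0#)
    term s φ with ext φ s
    ... | true = *-congʳ (*-comm _ _)
    ... | false = ≈-trans (*-congʳ (zeroʳ _)) (≈-trans (zeroˡ _) (≈-sym (zeroʳ _)))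
    at : ∀ s b → ΣL Φₗ (λ φ → PE i e * (if b ∧ ext φ s then PS i s else 0#) * pre φ e)
                 ≈ (if b then P∐ i (s , e) else 0#)
    at s false = ΣL-zero Φₗ (λ φ → ≈-trans (*-congʳ (zeroʳ _)) (zeroˡ _))
    at s true = begin
      ΣL Φₗ (λ φ → PE i e * (if ext φ s then PS i s else 0#) * pre φ e)
        ≈⟨ ΣL-cong Φₗ (term s) ⟩
      ΣL Φₗ (λ φ → (PS i s * PE i e) * (if ext φ s then pre φ e else 0#))
        ≈⟨ ΣL-*ˡ Φₗ _ _ ⟨
      (PS i s * PE i e) * ΣL Φₗ (λ φ → if ext φ s then pre φ e else 0#)
        ≈⟨ *-congˡ (ΣL-pre-ext≈preS e s) ⟩
      PS i s * PE i e * preS e s ∎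

  P∐⁺≈μ' : ∀ i X → P∐⁺ i X ≈ μ' i (gOf X)
  P∐⁺≈μ' i X = begin
    P∐⁺ i X
      ≈⟨ ΣL-cartesianProduct Sₗ Eₗ _ ⟩
    ΣL Sₗ (λ s → ΣL Eₗ (λ e → if X (s , e) then P∐ i (s , e) else 0#))
      ≈⟨ ΣL-swap Sₗ Eₗ _ ⟩
    ΣL Eₗ (λ e → ΣL Sₗ (λ s → if X (s , e) then P∐ i (s , e) else 0#))
      ≈⟨ ΣL-cong Eₗ (ΣΦ-μφ≈ΣS-P∐ i X) ⟨
    μ' i (gOf X) ∎

proposition7 : ∀ {c ℓ ℓ'} (R : CommutativeRing c ℓ) (_<_ : Rel (CommutativeRing.Carrier R) ℓ') →
    IsStrictPartialOrder (CommutativeRing._≈_ R) _<_ →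
    (Ag : Set) (n m k : ℕ) →
    (M : Prob.EpistemicStructure R _<_ Ag (suc n)) →
    (ℰ : Prob.ClassicalEvent R _<_ Ag (suc n) (suc m) k) →
    let open CommutativeRing R using (_≈_) in
    let open Prob.Construction R _<_ M ℰ in
    ((X : Sub SE) → unG (gOf X) ≐ X)
    × ((f : G) → gOf (unG f) ≐ᴳ f)
    × (∀ X Y → gOf (X ∪ₛ Y) ≐ᴳ (gOf X ∪ᴳ gOf Y))
    × (∀ X Y → gOf (X ∩ₛ Y) ≐ᴳ (gOf X ∩ᴳ gOf Y))
    × (∀ X → gOf (∁ₛ X) ≐ᴳ ∁ᴳ (gOf X))
    × (gOf ∅ₛ ≐ᴳ ⊥ᴳ)
    × (gOf Uₛ ≐ᴳ ⊤ᴳ)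
    × (∀ i X → gOf (◇∐ i X) ≐ᴳ ◇' i (gOf X))
    × (∀ i X → gOf (□∐ i X) ≐ᴳ □' i (gOf X))
    × (∀ i X → InOneClass (rel∐ i) X → Dom' i (gOf X))
    × (∀ i X → Dom' i (gOf X) → InOneClass (rel∐ i) X)
    × (∀ i X → InOneClass (rel∐ i) X → P∐⁺ i X ≈ μ' i (gOf X))
proposition7 R _<_ _ Ag n m k M ℰ =
  (λ X _ → refl) ,
  (λ f _ _ → refl) ,
  (λ X Y _ _ → refl) ,
  (λ X Y _ _ → refl) ,
  (λ X _ _ → refl) ,
  (λ _ _ → refl) ,
  (λ _ _ → refl) ,
  gOf-◇∐ M ℰ ,
  gOf-□∐ M ℰ ,
  InOneClass⇒Dom' M ℰ ,
  Dom'⇒InOneClass M ℰ ,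
  λ i X _ → P∐⁺≈μ' M ℰ i X
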